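{- Fix integers $r\geq 1$. For $n\geq 1$ let $A_n$ be the set of $r$-colored permutations $\sigma=(\sigma_1^{\epsilon_1},\dots,\sigma_n^{\epsilon_n})$ (with $\sigma_1\cdots\sigma_n$ a permutation of $[n]$ and colors $\epsilon_i\in\{0,1,\dots,r-1\}$) with $\epsilon_1=0$. For $0\leq s\leq r-1$, $1\leq j\leq n$ and integer $m$, let $A^{(s)}(n,j,m)$ be the number of $\sigma\in A_n$ with $\sigma_n=n+1-j$, $\epsilon_n=s$ and $\mathrm{des}(\sigma)=m$ (so $A^{(s)}(n,j,m)=0$ for $m<0$). Then for $d\geq 1$ and $0\leq k\leq d$: <ol> <li>$A^{(0)}(d+1,k+1,m)=A^{(0)}(d+1,d+1-k,d-m)$ for all $0\leq m\leq d$;</li> <li>for $s\neq 0$: $A^{(s)}(d+1,k+1,m)=A^{(r-s)}(d+1,d+1-k,d+1-m)$ for all $0\le m\le d+1$;</li> <li>$A^{(0)}(d+1,k+1,m)=\sum_{j=k}^{d-1}A^{(0)}(d,j+1,m)+\sum_{s=1}^{r-1}\sum_{j=0}^{d-1}A^{(s)}(d,j+1,m)+\sum_{j=0}^{k-1}A^{(0)}(d,j+1,m-1)$;</li> <li>for $s\neq 0$: $A^{(s)}(d+1,k+1,m)=\sum_{j=k}^{d-1}A^{(s)}(d,j+1,m)+\sum_{l=1}^{s-1}\sum_{j=0}^{d-1}A^{(l)}(d,j+1,m)+\sum_{j=0}^{d-1}A^{(0)}(d,j+1,m-1)+\sum_{j=0}^{k-1}A^{(s)}(d,j+1,m-1)+\sum_{l=s+1}^{r-1}\sum_{j=0}^{d-1}A^{(l)}(d,j+1,m-1)$.</li>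 </ol>
   Context: For an $r$-colored permutation $\sigma=(\sigma_1^{\epsilon_1},\dots,\sigma_n^{\epsilon_n})$ set $\sigma_{n+1}:=n+1$ and $\epsilon_{n+1}:=0$. The descent set is $\mathrm{Des}(\sigma)=\{1\leq i\leq n:\ \epsilon_i>\epsilon_{i+1}, \text{ or } \epsilon_i=\epsilon_{i+1}\text{ and }\sigma_i>\sigma_{i+1}\}$ (colors compared as integers $0<1<\dots<r-1$), and $\mathrm{des}(\sigma)=|\mathrm{Des}(\sigma)|$. In particular $n\in\mathrm{Des}(\sigma)$ iff $\epsilon_n\neq 0$. -}

module Defs where

open import Data.Bool using (Bool; true; false; _∧_; _∨_; not; if_then_else_)
open import Data.Nat using (ℕ; zero; suc; _+_; _∸_; _≡ᵇ_; _<ᵇ_)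
open import Data.Integer using (ℤ; +_)
open import Data.List using (List; []; _∷_; _++_; [_]; map; length; filterᵇ; applyUpTo; concatMap; last)
open import Data.Bool.ListAction using (any)
open import Data.Nat.ListAction using (sum)
open import Data.Maybe using (Maybe; just; nothing)
open import Data.Product using (_×_; _,_; proj₁; proj₂)

-- An r-colored permutation of [n] is represented as the list
-- ((σ₁ , ε₁) , … , (σₙ , εₙ)) of (value, color) pairs, values 1-based.
ColPerm : Set
ColPerm = List (ℕ × ℕ)

oneTo : ℕ → List ℕ
oneTo n = applyUpTo suc n

colors : ℕ → List ℕ
colors r = applyUpTo (λ i → i) r

allWords : (r n k : ℕ) → List ColPerm
allWords r n zero    = [] ∷ []
allWords r n (suc k) =
  concatMap (λ v → concatMap (λ c → map (λ w → (v , c) ∷ w) (allWords r n k)) (colors r)) (oneTo n)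

distinctVals : ColPerm → Bool
distinctVals []             = true
distinctVals ((v , _) ∷ w)  = not (any (λ p → proj₁ p ≡ᵇ v) w) ∧ distinctVals w

colPerms : (r n : ℕ) → List ColPerm
colPerms r n = filterᵇ distinctVals (allWords r n n)

isDescent : ℕ × ℕ → ℕ × ℕ → Bool
isDescent (a , e) (b , f) = (f <ᵇ e) ∨ ((e ≡ᵇ f) ∧ (b <ᵇ a))

countDesc : ColPerm → ℕ
countDesc []                = 0
countDesc (_ ∷ [])          = 0
countDesc (x ∷ y ∷ w)       = (if isDescent x y then 1 else 0) + countDesc (y ∷ w)

des : (n : ℕ) → ColPerm → ℕ
des n σ = countDesc (σ ++ [ (suc n , 0) ])

firstColorZero : ColPerm → Bool
firstColorZero []            = false
firstColorZero ((_ , e) ∷ _) = e ≡ᵇ 0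

lastIs : ℕ → ℕ → ColPerm → Bool
lastIs v s σ with last σ
... | nothing      = false
... | just (a , e) = (a ≡ᵇ v) ∧ (e ≡ᵇ s)

desIs : ℕ → ℤ → ColPerm → Bool
desIs n (+ m)      σ = des n σ ≡ᵇ m
desIs n (ℤ.negsuc _) σ = false

A : (r s n j : ℕ) → ℤ → ℕ
A r s n j m =
  length (filterᵇ (λ σ → firstColorZero σ ∧ lastIs (suc n ∸ j) s σ ∧ desIs n m σ) (colPerms r n))

-- Σ_{j = a}^{b-1} f j   (empty if b ≤ a)
sumFromTo : ℕ → ℕ → (ℕ → ℕ) → ℕ
sumFromTo a b f = sum (map f (applyUpTo (λ i → a + i) (b ∸ a)))

{-# OPTIONS --safe #-}
module Submission where

-- Let σ be counted by A^{(s)}(d+1, k+1, m), so that its last letter is v^s with v = d+1-k.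
-- Deleting that letter and standardising the values leaves a word of length d whose last
-- letter b^c decides how the descent number changes: the sentinel after the last letter
-- contributes [s ≠ 0] instead of [c ≠ 0], and the new pair (b', c)(v, s), b' the value of b
-- before standardisation, is a descent iff c > s, or c = s and b' > v.  Splitting the count
-- by c and b gives the recurrences (3) and (4).  The symmetries (1) and (2) then follow by
-- induction on d, since the right-hand sides of (3) and (4) are exchanged term by term under
-- j ↦ d-1-j, s ↦ r-s, m ↦ d-m (resp. d+1-m).

open import Defs
open import Function using (_∘_)
open import Data.Bool using (Bool; true; false; _∧_; _∨_; not; if_then_else_; T)
open import Data.Bool.Properties using (∧-assoc; ∧-zeroʳ; ∨-identityʳ; ∨-assoc; T-≡)
open import Data.Nat using (ℕ; zero; suc; _+_; _∸_; _≤_; _<_; z≤n; s≤s; _≡ᵇ_; _<ᵇ_)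
open import Data.Nat.Properties
open import Data.Nat.ListAction using (sum)
open import Data.Nat.Tactic.RingSolver using (solve-∀)
open import Algebra.Properties.CommutativeSemigroup +-commutativeSemigroup using (interchange)
open import Data.Integer using (ℤ; +_; _-_)
import Data.Integer as Z
open import Data.Integer.Properties using (pos-+; m-n≡m⊖n; ⊖-≥)
open import Data.Integer.Tactic.RingSolver using () renaming (solve-∀ to ℤ-solve-∀)
open import Data.List using (List; []; _∷_; _++_; [_]; map; length; filterᵇ; applyUpTo; concatMap; last)
open import Data.List.Properties using (map-++)
open import Data.Bool.ListAction using (any)
open import Data.Maybe using (just)
open import Data.Product using (_×_; _,_; proj₁; proj₂)
open import Data.Sum using (inj₁; inj₂)
open import Data.Empty using (⊥-elim)
open import Function.Bundles using (Equivalence)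
open import Relation.Nullary using (¬_)
open import Relation.Binary.PropositionalEquality hiding ([_])

-- Sums over ranges

sumBelow : ℕ → (ℕ → ℕ) → ℕ
sumBelow zero    f = 0
sumBelow (suc n) f = f 0 + sumBelow n (f ∘ suc)

sumBelow-cong : ∀ n {f g : ℕ → ℕ} → (∀ i → i < n → f i ≡ g i) → sumBelow n f ≡ sumBelow n g
sumBelow-cong zero    eq = refl
sumBelow-cong (suc n) eq = cong₂ _+_ (eq 0 (s≤s z≤n)) (sumBelow-cong n (λ i i<n → eq (suc i) (s≤s i<n)))

sumBelow-zero : ∀ n → sumBelow n (λ _ → 0) ≡ 0
sumBelow-zero zero    = refl
sumBelow-zero (suc n) = sumBelow-zero n

sumBelow-+ : ∀ n (f g : ℕ → ℕ) → sumBelow n (λ i → f i + g i) ≡ sumBelow n f + sumBelow n g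
sumBelow-+ zero    f g = refl
sumBelow-+ (suc n) f g = begin
    (f 0 + g 0) + sumBelow n (λ i → f (suc i) + g (suc i))
  ≡⟨ cong (_+_ (f 0 + g 0)) (sumBelow-+ n (f ∘ suc) (g ∘ suc)) ⟩
    (f 0 + g 0) + (sumBelow n (f ∘ suc) + sumBelow n (g ∘ suc))
  ≡⟨ interchange (f 0) (g 0) (sumBelow n (f ∘ suc)) (sumBelow n (g ∘ suc)) ⟩
    (f 0 + sumBelow n (f ∘ suc)) + (g 0 + sumBelow n (g ∘ suc)) ∎
  where open ≡-Reasoning

sumBelow-comm : ∀ n m (f : ℕ → ℕ → ℕ) →
  sumBelow n (λ i → sumBelow m (f i)) ≡ sumBelow m (λ j → sumBelow n (λ i → f i j))
sumBelow-comm zero    m f = sym (sumBelow-zero m)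
sumBelow-comm (suc n) m f =
  trans (cong (_+_ (sumBelow m (f 0))) (sumBelow-comm n m (f ∘ suc)))
        (sym (sumBelow-+ m (f 0) (λ j → sumBelow n (λ i → f (suc i) j))))

sumBelow-suc : ∀ n (f : ℕ → ℕ) → sumBelow (suc n) f ≡ sumBelow n f + f n
sumBelow-suc zero    f = +-comm (f 0) 0
sumBelow-suc (suc n) f =
  trans (cong (_+_ (f 0)) (sumBelow-suc n (f ∘ suc))) (sym (+-assoc (f 0) _ _))

sumBelow-+-length : ∀ a b (f : ℕ → ℕ) → sumBelow (a + b) f ≡ sumBelow a f + sumBelow b (λ i → f (a + i))
sumBelow-+-length zero    b f = refl
sumBelow-+-length (suc a) b f =
  trans (cong (_+_ (f 0)) (sumBelow-+-length a b (f ∘ suc))) (sym (+-assoc (f 0) _ _))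

sumBelow-around : ∀ s r (f : ℕ → ℕ) → s < r →
  sumBelow r f ≡ sumBelow s f + (f s + sumBelow (r ∸ suc s) (λ i → f (suc (s + i))))
sumBelow-around s r f s<r = begin
    sumBelow r f
  ≡⟨ cong (λ n → sumBelow n f) (m+[n∸m]≡n (<⇒≤ s<r)) ⟨
    sumBelow (s + (r ∸ s)) f
  ≡⟨ sumBelow-+-length s (r ∸ s) f ⟩
    sumBelow s f + sumBelow (r ∸ s) (λ i → f (s + i))
  ≡⟨ cong (λ n → sumBelow s f + sumBelow n (λ i → f (s + i))) (+-∸-assoc 1 s<r) ⟩
    sumBelow s f + (f (s + 0) + sumBelow (r ∸ suc s) (λ i → f (s + suc i)))
  ≡⟨ cong₂ (λ x y → sumBelow s f + (f x + y)) (+-identityʳ s)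
       (sumBelow-cong (r ∸ suc s) (λ i _ → cong f (+-suc s i))) ⟩
    sumBelow s f + (f s + sumBelow (r ∸ suc s) (λ i → f (suc (s + i)))) ∎
  where open ≡-Reasoning

sumBelow-reverse : ∀ n (f : ℕ → ℕ) → sumBelow n (λ j → f (n ∸ suc j)) ≡ sumBelow n f
sumBelow-reverse zero    f = refl
sumBelow-reverse (suc n) f = begin
    f n + sumBelow n (λ j → f (n ∸ suc j)) ≡⟨ cong (_+_ (f n)) (sumBelow-reverse n f) ⟩
    f n + sumBelow n f                     ≡⟨ +-comm (f n) _ ⟩
    sumBelow n f + f n                     ≡⟨ sumBelow-suc n f ⟨
    sumBelow (suc n) f                     ∎
  where open ≡-Reasoning

sumBelow-if : ∀ n b (f : ℕ → ℕ) → sumBelow n (λ i → if b then f i else 0) ≡ (if b then sumBelow n f else 0)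
sumBelow-if n true  f = refl
sumBelow-if n false f = sumBelow-zero n

sumBelow-indicator : ∀ n t (g : ℕ → ℕ) → t < n → sumBelow n (λ i → if i ≡ᵇ t then g i else 0) ≡ g t
sumBelow-indicator (suc n) zero    g _         = trans (cong (_+_ (g 0)) (sumBelow-zero n)) (+-identityʳ (g 0))
sumBelow-indicator (suc n) (suc t) g (s≤s t<n) = sumBelow-indicator n t (g ∘ suc) t<n

sum-map-applyUpTo : ∀ n (h f : ℕ → ℕ) → sum (map f (applyUpTo h n)) ≡ sumBelow n (f ∘ h)
sum-map-applyUpTo zero    h f = refl
sum-map-applyUpTo (suc n) h f = cong (_+_ (f (h 0))) (sum-map-applyUpTo n (h ∘ suc) f)

sumFromTo-sumBelow : ∀ a b f → sumFromTo a b f ≡ sumBelow (b ∸ a) (λ i → f (a + i))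
sumFromTo-sumBelow a b f = sum-map-applyUpTo (b ∸ a) (λ i → a + i) f

<∸⇒+< : ∀ a b i → i < b ∸ a → a + i < b
<∸⇒+< zero    b       i i< = i<
<∸⇒+< (suc a) (suc b) i i< = s≤s (<∸⇒+< a b i i<)

sumFromTo-cong : ∀ a b {f g : ℕ → ℕ} → (∀ i → a ≤ i → i < b → f i ≡ g i) → sumFromTo a b f ≡ sumFromTo a b g
sumFromTo-cong a b {f} {g} eq = begin
    sumFromTo a b f                      ≡⟨ sumFromTo-sumBelow a b f ⟩
    sumBelow (b ∸ a) (λ i → f (a + i))   ≡⟨ sumBelow-cong (b ∸ a) (λ i i< → eq (a + i) (m≤m+n a i) (<∸⇒+< a b i i<)) ⟩
    sumBelow (b ∸ a) (λ i → g (a + i))   ≡⟨ sumFromTo-sumBelow a b g ⟨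
    sumFromTo a b g                      ∎
  where open ≡-Reasoning

sumFromTo-reflect : ∀ a b N (F : ℕ → ℕ) → a ≤ b → b ≤ suc N →
  sumFromTo a b (λ l → F (N ∸ l)) ≡ sumFromTo (suc N ∸ b) (suc N ∸ a) F
sumFromTo-reflect a b N F a≤b b≤ = begin
    sumFromTo a b (λ l → F (N ∸ l))
  ≡⟨ sumFromTo-sumBelow a b _ ⟩
    sumBelow t (λ i → F (N ∸ (a + i)))
  ≡⟨ sumBelow-cong t (λ i i<t → cong F (reflected i i<t)) ⟩
    sumBelow t (λ i → F (u + (t ∸ suc i)))
  ≡⟨ sumBelow-reverse t (λ i → F (u + i)) ⟩
    sumBelow t (λ i → F (u + i))
  ≡⟨ cong (λ n → sumBelow n (λ i → F (u + i))) length≡ ⟨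
    sumBelow ((suc N ∸ a) ∸ u) (λ i → F (u + i))
  ≡⟨ sumFromTo-sumBelow u (suc N ∸ a) F ⟨
    sumFromTo u (suc N ∸ a) F ∎
  where
  open ≡-Reasoning
  t = b ∸ a
  u = suc N ∸ b
  N+1≡a+t+u : suc N ≡ a + t + u
  N+1≡a+t+u = trans (sym (m+[n∸m]≡n b≤)) (cong (_+ u) (sym (m+[n∸m]≡n a≤b)))
  reflected : ∀ i → i < t → N ∸ (a + i) ≡ u + (t ∸ suc i)
  reflected i i<t = begin
      suc N ∸ suc (a + i)          ≡⟨ cong₂ _∸_ (trans N+1≡a+t+u (+-assoc a t u)) (sym (+-suc a i)) ⟩
      (a + (t + u)) ∸ (a + suc i)  ≡⟨ [m+n]∸[m+o]≡n∸o a (t + u) (suc i) ⟩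
      (t + u) ∸ suc i              ≡⟨ cong (_∸ suc i) (+-comm t u) ⟩
      (u + t) ∸ suc i              ≡⟨ +-∸-assoc u i<t ⟩
      u + (t ∸ suc i)              ∎
  length≡ : (suc N ∸ a) ∸ u ≡ t
  length≡ = begin
      (suc N ∸ a) ∸ u              ≡⟨ cong (λ z → (z ∸ a) ∸ u) (trans N+1≡a+t+u (+-assoc a t u)) ⟩
      ((a + (t + u)) ∸ a) ∸ u      ≡⟨ cong (_∸ u) (m+n∸m≡n a (t + u)) ⟩
      (t + u) ∸ u                  ≡⟨ m+n∸n≡m t u ⟩
      t                            ∎

sumFromTo-reflect-by : ∀ n a b {f g : ℕ → ℕ} → (∀ j → j ≤ n → f j ≡ g (n ∸ j)) → a ≤ b → b ≤ suc n →
  sumFromTo a b f ≡ sumFromTo (suc n ∸ b) (suc n ∸ a) g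
sumFromTo-reflect-by n a b {f} {g} f≡g a≤b b≤ =
  trans (sumFromTo-cong a b (λ j _ j<b → f≡g j (≤-pred (≤-trans j<b b≤))))
        (sumFromTo-reflect a b n g a≤b b≤)

sumFromTo-reflect-prefix : ∀ n k {f g : ℕ → ℕ} → (∀ j → j ≤ n → f j ≡ g (n ∸ j)) → k ≤ suc n →
  sumFromTo 0 (suc n ∸ k) f ≡ sumFromTo k (suc n) g
sumFromTo-reflect-prefix n k {g = g} f≡g k≤ =
  trans (sumFromTo-reflect-by n 0 (suc n ∸ k) f≡g z≤n (m∸n≤m (suc n) k))
        (cong (λ x → sumFromTo x (suc n) g) (m∸[m∸n]≡n k≤))

sumFromTo-reflect-suffix : ∀ n k {f g : ℕ → ℕ} → (∀ j → j ≤ n → f j ≡ g (n ∸ j)) → k ≤ suc n →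
  sumFromTo (suc n ∸ k) (suc n) f ≡ sumFromTo 0 k g
sumFromTo-reflect-suffix n k {g = g} f≡g k≤ =
  trans (sumFromTo-reflect-by n (suc n ∸ k) (suc n) f≡g (m∸n≤m (suc n) k) ≤-refl)
        (cong₂ (λ x y → sumFromTo x y g) (n∸n≡0 (suc n)) (m∸[m∸n]≡n k≤))

sumFromTo-reflect-all : ∀ n {f g : ℕ → ℕ} → (∀ j → j ≤ n → f j ≡ g (n ∸ j)) →
  sumFromTo 0 (suc n) f ≡ sumFromTo 0 (suc n) g
sumFromTo-reflect-all n {g = g} f≡g =
  trans (sumFromTo-reflect-by n 0 (suc n) f≡g z≤n ≤-refl)
        (cong (λ x → sumFromTo x (suc n) g) (n∸n≡0 n))

-- Counting words

module _ {X : Set} where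

  length-filterᵇ-++ : ∀ (P : X → Bool) xs ys →
    length (filterᵇ P (xs ++ ys)) ≡ length (filterᵇ P xs) + length (filterᵇ P ys)
  length-filterᵇ-++ P []       ys = refl
  length-filterᵇ-++ P (x ∷ xs) ys with P x
  ... | true  = cong suc (length-filterᵇ-++ P xs ys)
  ... | false = length-filterᵇ-++ P xs ys

  length-filterᵇ-cong : ∀ {P Q : X → Bool} xs → (∀ x → P x ≡ Q x) → length (filterᵇ P xs) ≡ length (filterᵇ Q xs)
  length-filterᵇ-cong {P} {Q} []       eq = refl
  length-filterᵇ-cong {P} {Q} (x ∷ xs) eq with P x | Q x | eq x
  ... | true  | true  | refl = cong suc (length-filterᵇ-cong xs eq)
  ... | false | false | refl = length-filterᵇ-cong xs eq

  length-filterᵇ-false : ∀ xs → length (filterᵇ (λ (_ : X) → false) xs) ≡ 0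
  length-filterᵇ-false []       = refl
  length-filterᵇ-false (x ∷ xs) = length-filterᵇ-false xs

  length-filterᵇ-filterᵇ : ∀ (P Q : X → Bool) xs →
    length (filterᵇ Q (filterᵇ P xs)) ≡ length (filterᵇ (λ x → P x ∧ Q x) xs)
  length-filterᵇ-filterᵇ P Q []       = refl
  length-filterᵇ-filterᵇ P Q (x ∷ xs) with P x
  ... | false = length-filterᵇ-filterᵇ P Q xs
  ... | true with Q x
  ...   | true  = cong suc (length-filterᵇ-filterᵇ P Q xs)
  ...   | false = length-filterᵇ-filterᵇ P Q xs

  length-filterᵇ-concatMap : ∀ {Y : Set} (P : X → Bool) (f : Y → List X) ys →
    length (filterᵇ P (concatMap f ys)) ≡ sum (map (λ y → length (filterᵇ P (f y))) ys)
  length-filterᵇ-concatMap P f []       = refl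
  length-filterᵇ-concatMap P f (y ∷ ys) =
    trans (length-filterᵇ-++ P (f y) (concatMap f ys))
          (cong (_+_ (length (filterᵇ P (f y)))) (length-filterᵇ-concatMap P f ys))

  length-filterᵇ-map : ∀ {Y : Set} (P : X → Bool) (h : Y → X) ys →
    length (filterᵇ P (map h ys)) ≡ length (filterᵇ (P ∘ h) ys)
  length-filterᵇ-map P h []       = refl
  length-filterᵇ-map P h (y ∷ ys) with P (h y)
  ... | true  = cong suc (length-filterᵇ-map P h ys)
  ... | false = length-filterᵇ-map P h ys

count : (r n k : ℕ) → (ColPerm → Bool) → ℕ
count r n k P = length (filterᵇ P (allWords r n k))

count-cong : ∀ r n k {P Q : ColPerm → Bool} → (∀ w → P w ≡ Q w) → count r n k P ≡ count r n k Q
count-cong r n k eq = length-filterᵇ-cong (allWords r n k) eq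

count-zero : ∀ r n (P : ColPerm → Bool) → count r n 0 P ≡ (if P [] then 1 else 0)
count-zero r n P with P []
... | true  = refl
... | false = refl

count-suc : ∀ r n k (P : ColPerm → Bool) →
  count r n (suc k) P ≡ sumBelow n (λ a → sumBelow r (λ c → count r n k (λ w → P ((suc a , c) ∷ w))))
count-suc r n k P =
  trans (length-filterᵇ-concatMap P _ (oneTo n))
  (trans (sum-map-applyUpTo n suc _)
  (sumBelow-cong n (λ a _ → trans (length-filterᵇ-concatMap P _ (colors r))
    (trans (sum-map-applyUpTo r (λ i → i) _)
      (sumBelow-cong r (λ c _ → length-filterᵇ-map P _ (allWords r n k)))))))

count-snoc : ∀ r n k (P : ColPerm → Bool) →
  count r n (suc k) P ≡ sumBelow n (λ a → sumBelow r (λ c → count r n k (λ w → P (w ++ [ (suc a , c) ]))))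
count-snoc r n zero P = trans (count-suc r n 0 P)
  (sumBelow-cong n (λ a _ → sumBelow-cong r (λ c _ →
    trans (count-zero r n (λ w → P ((suc a , c) ∷ w))) (sym (count-zero r n (λ w → P (w ++ [ (suc a , c) ])))))))
count-snoc r n (suc k) P = begin
    count r n (suc (suc k)) P
  ≡⟨ count-suc r n (suc k) P ⟩
    sumBelow n (λ a → sumBelow r (λ c → count r n (suc k) (λ w → P ((suc a , c) ∷ w))))
  ≡⟨ sumBelow-cong n (λ a _ → sumBelow-cong r (λ c _ → count-snoc r n k _)) ⟩
    sumBelow n (λ a → sumBelow r (λ c → sumBelow n (λ a′ → sumBelow r (λ c′ → F a c a′ c′))))
  ≡⟨ comm₄ ⟩
    sumBelow n (λ a′ → sumBelow r (λ c′ → sumBelow n (λ a → sumBelow r (λ c → F a c a′ c′))))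
  ≡⟨ sumBelow-cong n (λ a′ _ → sumBelow-cong r (λ c′ _ → sym (count-suc r n k _))) ⟩
    sumBelow n (λ a′ → sumBelow r (λ c′ → count r n (suc k) (λ w → P (w ++ [ (suc a′ , c′) ])))) ∎
  where
  open ≡-Reasoning
  F : ℕ → ℕ → ℕ → ℕ → ℕ
  F a c a′ c′ = count r n k (λ w → P ((suc a , c) ∷ (w ++ [ (suc a′ , c′) ])))
  comm₄ : sumBelow n (λ a → sumBelow r (λ c → sumBelow n (λ a′ → sumBelow r (λ c′ → F a c a′ c′))))
        ≡ sumBelow n (λ a′ → sumBelow r (λ c′ → sumBelow n (λ a → sumBelow r (λ c → F a c a′ c′))))
  comm₄ =
    trans (sumBelow-cong n (λ a _ → sumBelow-comm r n (λ c a′ → sumBelow r (F a c a′))))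
    (trans (sumBelow-comm n n (λ a a′ → sumBelow r (λ c → sumBelow r (F a c a′))))
    (sumBelow-cong n (λ a′ _ → trans (sumBelow-cong n (λ a _ → sumBelow-comm r r (λ c c′ → F a c a′ c′)))
       (sumBelow-comm n r (λ a c′ → sumBelow r (λ c → F a c a′ c′))))))

count-guarded : ∀ r n k b (P : ColPerm → Bool) → count r n k (λ w → b ∧ P w) ≡ (if b then count r n k P else 0)
count-guarded r n k true  P = refl
count-guarded r n k false P = length-filterᵇ-false (allWords r n k)

¬T⇒≡false : ∀ {b} → ¬ T b → b ≡ false
¬T⇒≡false {true}  ¬t = ⊥-elim (¬t _)
¬T⇒≡false {false} _  = refl

<ᵇ-true : ∀ {m n} → m < n → (m <ᵇ n) ≡ true
<ᵇ-true m<n = Equivalence.to T-≡ (<⇒<ᵇ m<n)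

<ᵇ-false : ∀ {m n} → n ≤ m → (m <ᵇ n) ≡ false
<ᵇ-false {m} {n} n≤m = ¬T⇒≡false (λ t → <⇒≱ (<ᵇ⇒< m n t) n≤m)

≡ᵇ-refl : ∀ m → (m ≡ᵇ m) ≡ true
≡ᵇ-refl m = Equivalence.to T-≡ (≡⇒≡ᵇ m m refl)

≡ᵇ-false : ∀ {m n} → m ≢ n → (m ≡ᵇ n) ≡ false
≡ᵇ-false {m} {n} m≢n = ¬T⇒≡false (λ t → m≢n (≡ᵇ⇒≡ m n t))

≡ᵇ-comm : ∀ m n → (m ≡ᵇ n) ≡ (n ≡ᵇ m)
≡ᵇ-comm zero    zero    = refl
≡ᵇ-comm zero    (suc n) = refl
≡ᵇ-comm (suc m) zero    = refl
≡ᵇ-comm (suc m) (suc n) = ≡ᵇ-comm m n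

-- Standardisation

punchIn : ℕ → ℕ → ℕ
punchIn v b = if b <ᵇ v then b else suc b

punchIn-< : ∀ {v b} → b < v → punchIn v b ≡ b
punchIn-< {v} {b} b<v = cong (λ z → if z then b else suc b) (<ᵇ-true b<v)

punchIn-≥ : ∀ {v b} → v ≤ b → punchIn v b ≡ suc b
punchIn-≥ {v} {b} v≤b = cong (λ z → if z then b else suc b) (<ᵇ-false v≤b)

punchIn-<ᵇ : ∀ v x y → (punchIn v x <ᵇ punchIn v y) ≡ (x <ᵇ y)
punchIn-<ᵇ v x y with <-≤-connex x v | <-≤-connex y v
... | inj₁ x<v | inj₁ y<v rewrite punchIn-< x<v | punchIn-< y<v = refl
... | inj₁ x<v | inj₂ v≤y rewrite punchIn-< x<v | punchIn-≥ v≤y =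
      trans (<ᵇ-true (m≤n⇒m≤1+n (≤-trans x<v v≤y))) (sym (<ᵇ-true (<-≤-trans x<v v≤y)))
... | inj₂ v≤x | inj₁ y<v rewrite punchIn-≥ v≤x | punchIn-< y<v =
      trans (<ᵇ-false (≤-trans (<⇒≤ y<v) (m≤n⇒m≤1+n v≤x))) (sym (<ᵇ-false (≤-trans (<⇒≤ y<v) v≤x)))
... | inj₂ v≤x | inj₂ v≤y rewrite punchIn-≥ v≤x | punchIn-≥ v≤y = refl

punchIn-≡ᵇ : ∀ v x y → (punchIn v x ≡ᵇ punchIn v y) ≡ (x ≡ᵇ y)
punchIn-≡ᵇ v x y with <-≤-connex x v | <-≤-connex y v
... | inj₁ x<v | inj₁ y<v rewrite punchIn-< x<v | punchIn-< y<v = refl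
... | inj₁ x<v | inj₂ v≤y rewrite punchIn-< x<v | punchIn-≥ v≤y =
      trans (≡ᵇ-false (<⇒≢ (m≤n⇒m≤1+n (≤-trans x<v v≤y)))) (sym (≡ᵇ-false (<⇒≢ (<-≤-trans x<v v≤y))))
... | inj₂ v≤x | inj₁ y<v rewrite punchIn-≥ v≤x | punchIn-< y<v =
      trans (≡ᵇ-false (≢-sym (<⇒≢ (≤-trans y<v (m≤n⇒m≤1+n v≤x))))) (sym (≡ᵇ-false (≢-sym (<⇒≢ (<-≤-trans y<v v≤x)))))
... | inj₂ v≤x | inj₂ v≤y rewrite punchIn-≥ v≤x | punchIn-≥ v≤y = refl

punchInWord : ℕ → ColPerm → ColPerm
punchInWord v = map (λ p → (punchIn v (proj₁ p) , proj₂ p))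

avoids : ℕ → ColPerm → Bool
avoids v w = not (any (λ p → proj₁ p ≡ᵇ v) w)

any-punchInWord : ∀ v a (u : ColPerm) →
  any (λ p → proj₁ p ≡ᵇ punchIn v a) (punchInWord v u) ≡ any (λ p → proj₁ p ≡ᵇ a) u
any-punchInWord v a []            = refl
any-punchInWord v a ((x , c) ∷ u) = cong₂ _∨_ (punchIn-≡ᵇ v x a) (any-punchInWord v a u)

distinctVals-punchInWord : ∀ v (u : ColPerm) → distinctVals (punchInWord v u) ≡ distinctVals u
distinctVals-punchInWord v []            = refl
distinctVals-punchInWord v ((a , c) ∷ u) =
  cong₂ (λ x y → not x ∧ y) (any-punchInWord v a u) (distinctVals-punchInWord v u)

countDesc-punchInWord : ∀ v (u : ColPerm) → countDesc (punchInWord v u) ≡ countDesc u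
countDesc-punchInWord v []                        = refl
countDesc-punchInWord v (x ∷ [])                  = refl
countDesc-punchInWord v ((x , e) ∷ (y , f) ∷ u) =
  cong₂ _+_ (cong (λ z → if (f <ᵇ e) ∨ ((e ≡ᵇ f) ∧ z) then 1 else 0) (punchIn-<ᵇ v y x))
            (countDesc-punchInWord v ((y , f) ∷ u))

sumBelow-punchIn : ∀ d v (g : ℕ → ℕ) → 1 ≤ v → v ≤ suc d →
  sumBelow (suc d) (λ a → if not (suc a ≡ᵇ v) then g (suc a) else 0) ≡ sumBelow d (λ b → g (punchIn v (suc b)))
sumBelow-punchIn d v g 1≤v v≤ with m≤n⇒m<n∨m≡n v≤
sumBelow-punchIn d (suc d) g 1≤v v≤ | inj₂ refl = begin
    sumBelow (suc d) skipLast
  ≡⟨ sumBelow-suc d skipLast ⟩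
    sumBelow d skipLast + (if not (suc d ≡ᵇ suc d) then g (suc d) else 0)
  ≡⟨ cong (λ z → sumBelow d skipLast + (if not z then g (suc d) else 0)) (≡ᵇ-refl d) ⟩
    sumBelow d skipLast + 0
  ≡⟨ +-identityʳ _ ⟩
    sumBelow d skipLast
  ≡⟨ sumBelow-cong d (λ a a<d → trans
       (cong (λ z → if not z then g (suc a) else 0) (≡ᵇ-false (<⇒≢ a<d)))
       (cong g (sym (punchIn-< (s≤s a<d))))) ⟩
    sumBelow d (λ b → g (punchIn (suc d) (suc b))) ∎
  where
  open ≡-Reasoning
  skipLast = λ a → if not (suc a ≡ᵇ suc d) then g (suc a) else 0
sumBelow-punchIn (suc d) v g 1≤v v≤ | inj₁ (s≤s v≤d) = begin
    sumBelow (suc (suc d)) skip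
  ≡⟨ sumBelow-suc (suc d) skip ⟩
    sumBelow (suc d) skip + (if not (suc (suc d) ≡ᵇ v) then g (suc (suc d)) else 0)
  ≡⟨ cong₂ _+_ (sumBelow-punchIn d v g 1≤v v≤d)
       (cong (λ z → if not z then g (suc (suc d)) else 0) (≡ᵇ-false (≢-sym (<⇒≢ (s≤s v≤d))))) ⟩
    sumBelow d (λ b → g (punchIn v (suc b))) + g (suc (suc d))
  ≡⟨ cong (λ z → sumBelow d (λ b → g (punchIn v (suc b))) + g z) (sym (punchIn-≥ v≤d)) ⟩
    sumBelow d (λ b → g (punchIn v (suc b))) + g (punchIn v (suc d))
  ≡⟨ sumBelow-suc d (λ b → g (punchIn v (suc b))) ⟨
    sumBelow (suc d) (λ b → g (punchIn v (suc b))) ∎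
  where
  open ≡-Reasoning
  skip = λ a → if not (suc a ≡ᵇ v) then g (suc a) else 0
sumBelow-punchIn zero (suc zero) g 1≤v v≤ | inj₁ (s≤s ())

count-avoiding : ∀ r d v k (R : ColPerm → Bool) → 1 ≤ v → v ≤ suc d →
  count r (suc d) k (λ w → avoids v w ∧ R w) ≡ count r d k (R ∘ punchInWord v)
count-avoiding r d v zero    R 1≤v v≤ =
  trans (count-zero r (suc d) (λ w → avoids v w ∧ R w)) (sym (count-zero r d (R ∘ punchInWord v)))
count-avoiding r d v (suc k) R 1≤v v≤ = begin
    count r (suc d) (suc k) (λ w → avoids v w ∧ R w)
  ≡⟨ count-suc r (suc d) k _ ⟩
    sumBelow (suc d) (λ a → sumBelow r (λ c → count r (suc d) k (λ w → avoids v ((suc a , c) ∷ w) ∧ R ((suc a , c) ∷ w))))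
  ≡⟨ sumBelow-cong (suc d) (λ a _ → sumBelow-cong r (λ c _ → peel a c)) ⟩
    sumBelow (suc d) (λ a → sumBelow r (λ c → if not (suc a ≡ᵇ v) then G (suc a) c else 0))
  ≡⟨ sumBelow-cong (suc d) (λ a _ → sumBelow-if r (not (suc a ≡ᵇ v)) (G (suc a))) ⟩
    sumBelow (suc d) (λ a → if not (suc a ≡ᵇ v) then sumBelow r (G (suc a)) else 0)
  ≡⟨ sumBelow-punchIn d v (λ a → sumBelow r (G a)) 1≤v v≤ ⟩
    sumBelow d (λ b → sumBelow r (G (punchIn v (suc b))))
  ≡⟨ count-suc r d k (R ∘ punchInWord v) ⟨
    count r d (suc k) (R ∘ punchInWord v) ∎
  where
  open ≡-Reasoning
  G : ℕ → ℕ → ℕ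
  G a c = count r d k (λ u → R ((a , c) ∷ punchInWord v u))
  not-∨-∧ : ∀ x y z → not (x ∨ y) ∧ z ≡ not x ∧ (not y ∧ z)
  not-∨-∧ true  y z = refl
  not-∨-∧ false y z = refl
  peel : ∀ a c → count r (suc d) k (λ w → avoids v ((suc a , c) ∷ w) ∧ R ((suc a , c) ∷ w))
                 ≡ (if not (suc a ≡ᵇ v) then G (suc a) c else 0)
  peel a c = begin
      count r (suc d) k (λ w → avoids v ((suc a , c) ∷ w) ∧ R ((suc a , c) ∷ w))
    ≡⟨ count-cong r (suc d) k (λ w → not-∨-∧ (suc a ≡ᵇ v) (any (λ p → proj₁ p ≡ᵇ v) w) (R ((suc a , c) ∷ w))) ⟩
      count r (suc d) k (λ w → not (suc a ≡ᵇ v) ∧ (avoids v w ∧ R ((suc a , c) ∷ w)))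
    ≡⟨ count-guarded r (suc d) k (not (suc a ≡ᵇ v)) _ ⟩
      (if not (suc a ≡ᵇ v) then count r (suc d) k (λ w → avoids v w ∧ R ((suc a , c) ∷ w)) else 0)
    ≡⟨ cong (λ z → if not (suc a ≡ᵇ v) then z else 0) (count-avoiding r d v k (λ w → R ((suc a , c) ∷ w)) 1≤v v≤) ⟩
      (if not (suc a ≡ᵇ v) then G (suc a) c else 0) ∎

-- Fixing the last letter

last-++-[] : ∀ (w : ColPerm) x → last (w ++ [ x ]) ≡ just x
last-++-[] []          x = refl
last-++-[] (y ∷ [])    x = refl
last-++-[] (y ∷ z ∷ w) x = last-++-[] (z ∷ w) x

lastIs-++-[] : ∀ v s (w : ColPerm) a c → lastIs v s (w ++ [ (a , c) ]) ≡ (a ≡ᵇ v) ∧ (c ≡ᵇ s)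
lastIs-++-[] v s w a c with last (w ++ [ (a , c) ]) | last-++-[] w (a , c)
... | .(just (a , c)) | refl = refl

count-lastLetter : ∀ r n k v s (P : ColPerm → Bool) → v < n → s < r →
  count r n (suc k) (λ σ → lastIs (suc v) s σ ∧ P σ) ≡ count r n k (λ w → P (w ++ [ (suc v , s) ]))
count-lastLetter r n k v s P v<n s<r = begin
    count r n (suc k) (λ σ → lastIs (suc v) s σ ∧ P σ)
  ≡⟨ count-snoc r n k _ ⟩
    sumBelow n (λ a → sumBelow r (λ c → count r n k (λ w → lastIs (suc v) s (w ++ [ (suc a , c) ]) ∧ P (w ++ [ (suc a , c) ]))))
  ≡⟨ sumBelow-cong n (λ a _ → sumBelow-cong r (λ c _ → lastLetter a c)) ⟩
    sumBelow n (λ a → sumBelow r (λ c → if a ≡ᵇ v then (if c ≡ᵇ s then F a c else 0) else 0))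
  ≡⟨ sumBelow-cong n (λ a _ → sumBelow-if r (a ≡ᵇ v) (λ c → if c ≡ᵇ s then F a c else 0)) ⟩
    sumBelow n (λ a → if a ≡ᵇ v then sumBelow r (λ c → if c ≡ᵇ s then F a c else 0) else 0)
  ≡⟨ sumBelow-cong n (λ a _ → cong (λ z → if a ≡ᵇ v then z else 0) (sumBelow-indicator r s (F a) s<r)) ⟩
    sumBelow n (λ a → if a ≡ᵇ v then F a s else 0)
  ≡⟨ sumBelow-indicator n v (λ a → F a s) v<n ⟩
    F v s ∎
  where
  open ≡-Reasoning
  F : ℕ → ℕ → ℕ
  F a c = count r n k (λ w → P (w ++ [ (suc a , c) ]))
  if-∧ : ∀ p q x → (if p ∧ q then x else 0) ≡ (if p then (if q then x else 0) else 0)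
  if-∧ true  q x = refl
  if-∧ false q x = refl
  lastLetter : ∀ a c → count r n k (λ w → lastIs (suc v) s (w ++ [ (suc a , c) ]) ∧ P (w ++ [ (suc a , c) ]))
                      ≡ (if a ≡ᵇ v then (if c ≡ᵇ s then F a c else 0) else 0)
  lastLetter a c =
    trans (count-cong r n k (λ w → cong (_∧ P (w ++ [ (suc a , c) ])) (lastIs-++-[] (suc v) s w (suc a) c)))
    (trans (count-guarded r n k ((a ≡ᵇ v) ∧ (c ≡ᵇ s)) (λ w → P (w ++ [ (suc a , c) ])))
           (if-∧ (a ≡ᵇ v) (c ≡ᵇ s) (F a c)))

Aᵛ : (r s n v : ℕ) → ℤ → ℕ
Aᵛ r s n v m = count r (suc n) n (λ w →
  distinctVals (w ++ [ (v , s) ]) ∧ firstColorZero (w ++ [ (v , s) ]) ∧ desIs (suc n) m (w ++ [ (v , s) ]))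

A≡Aᵛ : ∀ r s n j m → s < r → j ≤ n → A r s (suc n) (suc j) m ≡ Aᵛ r s n (suc (n ∸ j)) m
A≡Aᵛ r s n j m s<r j≤n = begin
    A r s (suc n) (suc j) m
  ≡⟨ cong (λ v → length (filterᵇ (isA v) (colPerms r (suc n)))) (+-∸-assoc 1 j≤n) ⟩
    length (filterᵇ (isA (suc (n ∸ j))) (colPerms r (suc n)))
  ≡⟨ length-filterᵇ-filterᵇ distinctVals (isA (suc (n ∸ j))) (allWords r (suc n) (suc n)) ⟩
    count r (suc n) (suc n) (λ σ → distinctVals σ ∧ isA (suc (n ∸ j)) σ)
  ≡⟨ count-cong r (suc n) (suc n) (λ σ → reorder (distinctVals σ) (firstColorZero σ) (lastIs (suc (n ∸ j)) s σ) _) ⟩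
    count r (suc n) (suc n) (λ σ → lastIs (suc (n ∸ j)) s σ ∧ (distinctVals σ ∧ firstColorZero σ ∧ desIs (suc n) m σ))
  ≡⟨ count-lastLetter r (suc n) n (n ∸ j) s _ (s≤s (m∸n≤m n j)) s<r ⟩
    Aᵛ r s n (suc (n ∸ j)) m ∎
  where
  open ≡-Reasoning
  isA : ℕ → ColPerm → Bool
  isA v σ = firstColorZero σ ∧ lastIs v s σ ∧ desIs (suc n) m σ
  reorder : ∀ x y z t → x ∧ (y ∧ (z ∧ t)) ≡ z ∧ (x ∧ (y ∧ t))
  reorder true  true  z t = refl
  reorder true  false z t = sym (∧-zeroʳ z)
  reorder false y     z t = sym (∧-zeroʳ z)

sumFromTo-A≡Aᵛ : ∀ r s d′ μ a b → s < r → a ≤ b → b ≤ suc d′ →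
  sumFromTo a b (λ j → A r s (suc d′) (suc j) μ) ≡ sumFromTo (suc d′ ∸ b) (suc d′ ∸ a) (λ i → Aᵛ r s d′ (suc i) μ)
sumFromTo-A≡Aᵛ r s d′ μ a b s<r a≤b b≤ =
  sumFromTo-reflect-by d′ a b (λ j j≤d′ → A≡Aᵛ r s d′ j μ s<r j≤d′) a≤b b≤

Aᵛ-total : ∀ r s d′ μ → s < r →
  sumBelow (suc d′) (λ i → Aᵛ r s d′ (suc i) μ) ≡ sumFromTo 0 (suc d′) (λ j → A r s (suc d′) (suc j) μ)
Aᵛ-total r s d′ μ s<r = sym (begin
    sumFromTo 0 d (λ j → A r s d (suc j) μ)
  ≡⟨ sumFromTo-A≡Aᵛ r s d′ μ 0 d s<r z≤n ≤-refl ⟩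
    sumFromTo (d ∸ d) d (λ i → Aᵛ r s d′ (suc i) μ)
  ≡⟨ cong (λ x → sumFromTo x d (λ i → Aᵛ r s d′ (suc i) μ)) (n∸n≡0 d) ⟩
    sumFromTo 0 d (λ i → Aᵛ r s d′ (suc i) μ)
  ≡⟨ sumFromTo-sumBelow 0 d (λ i → Aᵛ r s d′ (suc i) μ) ⟩
    sumBelow d (λ i → Aᵛ r s d′ (suc i) μ) ∎)
  where
  open ≡-Reasoning
  d = suc d′

-- Descents

any-++-[] : ∀ (w : ColPerm) x a → any (λ p → proj₁ p ≡ᵇ a) (w ++ [ x ]) ≡ any (λ p → proj₁ p ≡ᵇ a) w ∨ (proj₁ x ≡ᵇ a)
any-++-[] []            x a = ∨-identityʳ _
any-++-[] ((y , c) ∷ w) x a = trans (cong ((y ≡ᵇ a) ∨_) (any-++-[] w x a)) (sym (∨-assoc (y ≡ᵇ a) _ _))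

distinctVals-++-[] : ∀ (w : ColPerm) v s → distinctVals (w ++ [ (v , s) ]) ≡ avoids v w ∧ distinctVals w
distinctVals-++-[] []            v s = refl
distinctVals-++-[] ((a , c) ∷ w) v s = begin
    not (any (λ p → proj₁ p ≡ᵇ a) (w ++ [ (v , s) ])) ∧ distinctVals (w ++ [ (v , s) ])
  ≡⟨ cong₂ (λ x y → not x ∧ y) (any-++-[] w (v , s) a) (distinctVals-++-[] w v s) ⟩
    not (anyW a ∨ (v ≡ᵇ a)) ∧ (not (anyW v) ∧ distinctVals w)
  ≡⟨ exchange (anyW a) (v ≡ᵇ a) (anyW v) (distinctVals w) ⟩
    not ((v ≡ᵇ a) ∨ anyW v) ∧ (not (anyW a) ∧ distinctVals w)
  ≡⟨ cong (λ z → not (z ∨ anyW v) ∧ (not (anyW a) ∧ distinctVals w)) (≡ᵇ-comm v a) ⟩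
    not ((a ≡ᵇ v) ∨ anyW v) ∧ (not (anyW a) ∧ distinctVals w) ∎
  where
  open ≡-Reasoning
  anyW : ℕ → Bool
  anyW x = any (λ p → proj₁ p ≡ᵇ x) w
  exchange : ∀ x e n t → not (x ∨ e) ∧ (not n ∧ t) ≡ not (e ∨ n) ∧ (not x ∧ t)
  exchange true  true  n     t = refl
  exchange true  false true  t = refl
  exchange true  false false t = refl
  exchange false true  n     t = refl
  exchange false false n     t = refl

firstColorZero-punchInWord : ∀ v (u : ColPerm) x y →
  firstColorZero (punchInWord v (u ++ [ x ]) ++ [ y ]) ≡ firstColorZero (u ++ [ x ])
firstColorZero-punchInWord v []      x y = refl
firstColorZero-punchInWord v (z ∷ u) x y = refl

indicator : Bool → ℕ
indicator b = if b then 1 else 0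

countDesc-++-[] : ∀ (w : ColPerm) x y →
  countDesc ((w ++ [ x ]) ++ [ y ]) ≡ countDesc (w ++ [ x ]) + indicator (isDescent x y)
countDesc-++-[] []          x y = +-comm (indicator (isDescent x y)) 0
countDesc-++-[] (z ∷ [])    x y =
  trans (cong (_+_ (indicator (isDescent z x))) (+-comm (indicator (isDescent x y)) 0))
        (cong (_+ indicator (isDescent x y)) (sym (+-identityʳ (indicator (isDescent z x)))))
countDesc-++-[] (z ∷ z′ ∷ w) x y =
  trans (cong (_+_ (indicator (isDescent z z′))) (countDesc-++-[] (z′ ∷ w) x y))
        (sym (+-assoc (indicator (isDescent z z′)) _ _))

isDescent-sentinel : ∀ {n} b c → b ≤ n → isDescent (b , c) (n , 0) ≡ (0 <ᵇ c)
isDescent-sentinel {n} b c b≤n =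
  trans (cong (λ z → (0 <ᵇ c) ∨ ((c ≡ᵇ 0) ∧ z)) (<ᵇ-false b≤n)) (∨-false-∧ (0 <ᵇ c) (c ≡ᵇ 0))
  where
  ∨-false-∧ : ∀ x y → x ∨ (y ∧ false) ≡ x
  ∨-false-∧ x y = trans (cong (x ∨_) (∧-zeroʳ y)) (∨-identityʳ x)

isDescent-sameColour : ∀ x y s → isDescent (x , s) (y , s) ≡ (y <ᵇ x)
isDescent-sameColour x y s = cong₂ (λ p q → p ∨ (q ∧ (y <ᵇ x))) (<ᵇ-false (≤-refl {s})) (≡ᵇ-refl s)

-- Standardisation preserves all comparisons of values, so only the comparisons with v^s and
-- with the sentinels differ.
des-punchIn : ∀ d v s (u : ColPerm) b c → b ≤ suc d → v ≤ suc (suc d) →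
  des (suc d) (punchInWord v (u ++ [ (b , c) ]) ++ [ (v , s) ]) + indicator (0 <ᵇ c)
  ≡ des d (u ++ [ (b , c) ]) + indicator (isDescent (punchIn v b , c) (v , s)) + indicator (0 <ᵇ s)
des-punchIn d v s u b c b≤ v≤ = begin
    des (suc d) W + indicator (0 <ᵇ c)
  ≡⟨ cong (_+ indicator (0 <ᵇ c)) (countDesc-++-[] (punchInWord v X) (v , s) (suc (suc d) , 0)) ⟩
    countDesc (punchInWord v X ++ [ (v , s) ]) + indicator (isDescent (v , s) (suc (suc d) , 0)) + indicator (0 <ᵇ c)
  ≡⟨ cong (λ z → countDesc (z ++ [ (v , s) ]) + indicator (isDescent (v , s) (suc (suc d) , 0)) + indicator (0 <ᵇ c))
          (map-++ _ u [ (b , c) ]) ⟩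
    countDesc ((punchInWord v u ++ [ (punchIn v b , c) ]) ++ [ (v , s) ]) + indicator (isDescent (v , s) (suc (suc d) , 0)) + indicator (0 <ᵇ c)
  ≡⟨ cong₂ (λ x y → x + y + indicator (0 <ᵇ c))
       (trans (countDesc-++-[] (punchInWord v u) (punchIn v b , c) (v , s))
              (cong (_+ indicator Iv) (trans (cong countDesc (sym (map-++ _ u [ (b , c) ]))) (countDesc-punchInWord v X))))
       (cong indicator (isDescent-sentinel v s v≤)) ⟩
    countDesc X + indicator Iv + indicator (0 <ᵇ s) + indicator (0 <ᵇ c)
  ≡⟨ rearrange (countDesc X) (indicator Iv) (indicator (0 <ᵇ s)) (indicator (0 <ᵇ c)) ⟩
    countDesc X + indicator (0 <ᵇ c) + indicator Iv + indicator (0 <ᵇ s)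
  ≡⟨ cong (λ z → countDesc X + indicator z + indicator Iv + indicator (0 <ᵇ s)) (isDescent-sentinel b c b≤) ⟨
    countDesc X + indicator (isDescent (b , c) (suc d , 0)) + indicator Iv + indicator (0 <ᵇ s)
  ≡⟨ cong (λ z → z + indicator Iv + indicator (0 <ᵇ s)) (countDesc-++-[] u (b , c) (suc d , 0)) ⟨
    des d X + indicator Iv + indicator (0 <ᵇ s) ∎
  where
  open ≡-Reasoning
  X = u ++ [ (b , c) ]
  W = punchInWord v X ++ [ (v , s) ]
  Iv = isDescent (punchIn v b , c) (v , s)
  rearrange : ∀ p q t e → p + q + t + e ≡ p + e + q + t
  rearrange = solve-∀

desIs-cong : ∀ n₁ n₂ m σ₁ σ₂ → des n₁ σ₁ ≡ des n₂ σ₂ → desIs n₁ m σ₁ ≡ desIs n₂ m σ₂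
desIs-cong n₁ n₂ (+ m)        σ₁ σ₂ eq = cong (_≡ᵇ m) eq
desIs-cong n₁ n₂ (ℤ.negsuc m) σ₁ σ₂ eq = refl

desIs-suc : ∀ n₁ n₂ m σ₁ σ₂ → des n₁ σ₁ ≡ suc (des n₂ σ₂) → desIs n₁ m σ₁ ≡ desIs n₂ (m - + 1) σ₂
desIs-suc n₁ n₂ (+ zero)     σ₁ σ₂ eq = cong (_≡ᵇ 0) eq
desIs-suc n₁ n₂ (+ suc m)    σ₁ σ₂ eq = cong (_≡ᵇ suc m) eq
desIs-suc n₁ n₂ (ℤ.negsuc m) σ₁ σ₂ eq = refl

-- The recurrences

isAEndingIn : ℕ → ℕ → ℕ → ℤ → ColPerm → Bool
isAEndingIn n v s m w = distinctVals w ∧ firstColorZero (w ++ [ (v , s) ]) ∧ desIs (suc n) m (w ++ [ (v , s) ])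

-- Aᵛᵛ r d v s a c m counts the permutations of [d+2] counted by A whose last two letters are
-- (punchIn v (a+1))^c and v^s, through the standardisation of their first d letters.
Aᵛᵛ : (r d v s a c : ℕ) → ℤ → ℕ
Aᵛᵛ r d v s a c m = count r (suc d) d (λ u → isAEndingIn (suc d) v s m (punchInWord v (u ++ [ (suc a , c) ])))

Aᵛᵛ≡Aᵛ-shift : ∀ r d v s a c m μ →
  (∀ u → desIs (suc (suc d)) m (punchInWord v (u ++ [ (suc a , c) ]) ++ [ (v , s) ]) ≡ desIs (suc d) μ (u ++ [ (suc a , c) ])) →
  Aᵛᵛ r d v s a c m ≡ Aᵛ r c d (suc a) μ
Aᵛᵛ≡Aᵛ-shift r d v s a c m μ des≡ = count-cong r (suc d) d (λ u →
  cong₂ _∧_ (distinctVals-punchInWord v (u ++ [ (suc a , c) ]))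
            (cong₂ _∧_ (firstColorZero-punchInWord v u (suc a , c) (v , s)) (des≡ u)))

module LastTwoLetters (r d′ v : ℕ) (m : ℤ) (a : ℕ) (a<d : a < suc d′) (v≤ : v ≤ suc (suc d′)) where

  private
    d = suc d′

    descentΔ : ℕ → ℕ → ℕ
    descentΔ s c = indicator (isDescent (punchIn v (suc a) , c) (v , s)) + indicator (0 <ᵇ s)

    des-punchIn′ : ∀ s c u → des (suc d) (punchInWord v (u ++ [ (suc a , c) ]) ++ [ (v , s) ]) + indicator (0 <ᵇ c)
                             ≡ des d (u ++ [ (suc a , c) ]) + descentΔ s c
    des-punchIn′ s c u = trans (des-punchIn d v s u (suc a) c (m≤n⇒m≤1+n a<d) (m≤n⇒m≤1+n v≤))
                               (+-assoc (des d (u ++ [ (suc a , c) ])) _ _)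

  Aᵛᵛ≡Aᵛ : ∀ s c → descentΔ s c ≡ indicator (0 <ᵇ c) → Aᵛᵛ r d′ v s a c m ≡ Aᵛ r c d′ (suc a) m
  Aᵛᵛ≡Aᵛ s c Δ≡ = Aᵛᵛ≡Aᵛ-shift r d′ v s a c m m (λ u → desIs-cong (suc d) d m _ _
    (+-cancelʳ-≡ (indicator (0 <ᵇ c)) _ _ (trans (des-punchIn′ s c u) (cong (_+_ (des d (u ++ [ (suc a , c) ]))) Δ≡))))

  Aᵛᵛ≡Aᵛ-1 : ∀ s c → descentΔ s c ≡ suc (indicator (0 <ᵇ c)) → Aᵛᵛ r d′ v s a c m ≡ Aᵛ r c d′ (suc a) (m - + 1)
  Aᵛᵛ≡Aᵛ-1 s c Δ≡ = Aᵛᵛ≡Aᵛ-shift r d′ v s a c m (m - + 1) (λ u → desIs-suc (suc d) d m _ _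
    (+-cancelʳ-≡ (indicator (0 <ᵇ c)) _ _ (trans (des-punchIn′ s c u)
      (trans (cong (_+_ (des d (u ++ [ (suc a , c) ]))) Δ≡) (+-suc (des d (u ++ [ (suc a , c) ])) _)))))

  Aᵛᵛ-c≡s : ∀ s → Aᵛᵛ r d′ v s a s m ≡ Aᵛ r s d′ (suc a) (if suc a <ᵇ v then m else m - + 1)
  Aᵛᵛ-c≡s s with <-≤-connex (suc a) v
  ... | inj₁ a+1<v rewrite <ᵇ-true a+1<v = Aᵛᵛ≡Aᵛ s s (cong (λ z → indicator z + indicator (0 <ᵇ s))
        (trans (isDescent-sameColour (punchIn v (suc a)) v s) (trans (cong (v <ᵇ_) (punchIn-< a+1<v)) (<ᵇ-false (<⇒≤ a+1<v)))))
  ... | inj₂ v≤a+1 rewrite <ᵇ-false v≤a+1 = Aᵛᵛ≡Aᵛ-1 s s (cong (λ z → indicator z + indicator (0 <ᵇ s))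
        (trans (isDescent-sameColour (punchIn v (suc a)) v s) (trans (cong (v <ᵇ_) (punchIn-≥ v≤a+1)) (<ᵇ-true (s≤s v≤a+1)))))

  Aᵛᵛ-0≡c<s : ∀ s′ → Aᵛᵛ r d′ v (suc s′) a 0 m ≡ Aᵛ r 0 d′ (suc a) (m - + 1)
  Aᵛᵛ-0≡c<s s′ = Aᵛᵛ≡Aᵛ-1 (suc s′) 0 refl

  Aᵛᵛ-0<c<s : ∀ s′ c′ → c′ < s′ → Aᵛᵛ r d′ v (suc s′) a (suc c′) m ≡ Aᵛ r (suc c′) d′ (suc a) m
  Aᵛᵛ-0<c<s s′ c′ c′<s′ = Aᵛᵛ≡Aᵛ (suc s′) (suc c′) (cong (λ z → indicator z + 1)
    (cong₂ (λ p q → p ∨ (q ∧ (v <ᵇ punchIn v (suc a)))) (<ᵇ-false (<⇒≤ c′<s′)) (≡ᵇ-false (<⇒≢ c′<s′))))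

  Aᵛᵛ-0≡s<c : ∀ c′ → Aᵛᵛ r d′ v 0 a (suc c′) m ≡ Aᵛ r (suc c′) d′ (suc a) m
  Aᵛᵛ-0≡s<c c′ = Aᵛᵛ≡Aᵛ 0 (suc c′) refl

  Aᵛᵛ-0<s<c : ∀ s′ c′ → s′ < c′ → Aᵛᵛ r d′ v (suc s′) a (suc c′) m ≡ Aᵛ r (suc c′) d′ (suc a) (m - + 1)
  Aᵛᵛ-0<s<c s′ c′ s′<c′ = Aᵛᵛ≡Aᵛ-1 (suc s′) (suc c′) (cong (λ z → indicator (z ∨ ((c′ ≡ᵇ s′) ∧ (v <ᵇ punchIn v (suc a)))) + 1)
    (<ᵇ-true s′<c′))

A-lastTwoLetters : ∀ r d′ k s m → k ≤ suc d′ → s < r →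
  A r s (suc (suc d′)) (suc k) m ≡ sumBelow r (λ c → sumBelow (suc d′) (λ a → Aᵛᵛ r d′ (suc (suc d′ ∸ k)) s a c m))
A-lastTwoLetters r d′ k s m k≤d s<r = begin
    A r s (suc d) (suc k) m
  ≡⟨ A≡Aᵛ r s d k m s<r k≤d ⟩
    Aᵛ r s d v m
  ≡⟨ count-cong r (suc d) d (λ w →
       trans (cong (_∧ lastConditions w) (distinctVals-++-[] w v s)) (∧-assoc (avoids v w) (distinctVals w) (lastConditions w))) ⟩
    count r (suc d) d (λ w → avoids v w ∧ isAEndingIn d v s m w)
  ≡⟨ count-avoiding r d v d (isAEndingIn d v s m) (s≤s z≤n) (s≤s (m∸n≤m d k)) ⟩
    count r d d (isAEndingIn d v s m ∘ punchInWord v)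
  ≡⟨ count-snoc r d d′ (isAEndingIn d v s m ∘ punchInWord v) ⟩
    sumBelow d (λ a → sumBelow r (λ c → Aᵛᵛ r d′ v s a c m))
  ≡⟨ sumBelow-comm d r (λ a c → Aᵛᵛ r d′ v s a c m) ⟩
    sumBelow r (λ c → sumBelow d (λ a → Aᵛᵛ r d′ v s a c m)) ∎
  where
  open ≡-Reasoning
  d = suc d′
  v = suc (d ∸ k)
  lastConditions : ColPerm → Bool
  lastConditions w = firstColorZero (w ++ [ (v , s) ]) ∧ desIs (suc d) m (w ++ [ (v , s) ])

Aᵛ-sameColour : ∀ r s d′ k m → s < r → k ≤ suc d′ →
  sumBelow (suc d′) (λ a → Aᵛ r s d′ (suc a) (if suc a <ᵇ suc (suc d′ ∸ k) then m else m - + 1))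
  ≡ sumFromTo k (suc d′) (λ j → A r s (suc d′) (suc j) m) + sumFromTo 0 k (λ j → A r s (suc d′) (suc j) (m - + 1))
Aᵛ-sameColour r s d′ k m s<r k≤d = begin
    sumBelow d (λ a → F a (μ a))
  ≡⟨ cong (λ n → sumBelow n (λ a → F a (μ a))) (m∸n+n≡m k≤d) ⟨
    sumBelow (d ∸ k + k) (λ a → F a (μ a))
  ≡⟨ sumBelow-+-length (d ∸ k) k (λ a → F a (μ a)) ⟩
    sumBelow (d ∸ k) (λ a → F a (μ a)) + sumBelow k (λ i → F (d ∸ k + i) (μ (d ∸ k + i)))
  ≡⟨ cong₂ _+_ (sumBelow-cong (d ∸ k) (λ a a< → cong (F a) (below a a<)))
               (sumBelow-cong k (λ i _ → cong (F (d ∸ k + i)) (above i))) ⟩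
    sumBelow (d ∸ k) (λ a → F a m) + sumBelow k (λ i → F (d ∸ k + i) (m - + 1))
  ≡⟨ cong₂ _+_ upper lower ⟨
    sumFromTo k d (λ j → A r s d (suc j) m) + sumFromTo 0 k (λ j → A r s d (suc j) (m - + 1)) ∎
  where
  open ≡-Reasoning
  d = suc d′
  F : ℕ → ℤ → ℕ
  F a = Aᵛ r s d′ (suc a)
  μ : ℕ → ℤ
  μ a = if suc a <ᵇ suc (d ∸ k) then m else m - + 1
  below : ∀ a → a < d ∸ k → μ a ≡ m
  below a a< = cong (λ z → if z then m else m - + 1) (<ᵇ-true (s≤s a<))
  above : ∀ i → μ (d ∸ k + i) ≡ m - + 1
  above i = cong (λ z → if z then m else m - + 1) (<ᵇ-false (s≤s (m≤m+n (d ∸ k) i)))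
  upper : sumFromTo k d (λ j → A r s d (suc j) m) ≡ sumBelow (d ∸ k) (λ a → F a m)
  upper = begin
      sumFromTo k d (λ j → A r s d (suc j) m)
    ≡⟨ sumFromTo-A≡Aᵛ r s d′ m k d s<r k≤d ≤-refl ⟩
      sumFromTo (d ∸ d) (d ∸ k) (λ a → F a m)
    ≡⟨ cong (λ x → sumFromTo x (d ∸ k) (λ a → F a m)) (n∸n≡0 d) ⟩
      sumFromTo 0 (d ∸ k) (λ a → F a m)
    ≡⟨ sumFromTo-sumBelow 0 (d ∸ k) (λ a → F a m) ⟩
      sumBelow (d ∸ k) (λ a → F a m) ∎
  lower : sumFromTo 0 k (λ j → A r s d (suc j) (m - + 1)) ≡ sumBelow k (λ i → F (d ∸ k + i) (m - + 1))
  lower = begin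
      sumFromTo 0 k (λ j → A r s d (suc j) (m - + 1))
    ≡⟨ sumFromTo-A≡Aᵛ r s d′ (m - + 1) 0 k s<r z≤n k≤d ⟩
      sumFromTo (d ∸ k) d (λ a → F a (m - + 1))
    ≡⟨ sumFromTo-sumBelow (d ∸ k) d (λ a → F a (m - + 1)) ⟩
      sumBelow (d ∸ (d ∸ k)) (λ i → F (d ∸ k + i) (m - + 1))
    ≡⟨ cong (λ n → sumBelow n (λ i → F (d ∸ k + i) (m - + 1))) (m∸[m∸n]≡n k≤d) ⟩
      sumBelow k (λ i → F (d ∸ k + i) (m - + 1)) ∎

recurrence-colour0 : ∀ r d′ k → 1 ≤ r → k ≤ suc d′ → (m : ℤ) →
  A r 0 (suc (suc d′)) (suc k) m
    ≡ sumFromTo k (suc d′) (λ j → A r 0 (suc d′) (suc j) m)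
      + sumFromTo 1 r (λ s → sumFromTo 0 (suc d′) (λ j → A r s (suc d′) (suc j) m))
      + sumFromTo 0 k (λ j → A r 0 (suc d′) (suc j) (m - + 1))
recurrence-colour0 (suc r′) d′ k _ k≤d m = begin
    A r 0 (suc d) (suc k) m
  ≡⟨ A-lastTwoLetters r d′ k 0 m k≤d (s≤s z≤n) ⟩
    sumBelow d (λ a → K a 0) + sumBelow r′ (λ c → sumBelow d (λ a → K a (suc c)))
  ≡⟨ cong₂ _+_
       (trans (sumBelow-cong d (λ a a<d → LastTwoLetters.Aᵛᵛ-c≡s r d′ v m a a<d v≤ 0))
              (Aᵛ-sameColour r 0 d′ k m (s≤s z≤n) k≤d))
       (trans (sumBelow-cong r′ (λ c c<r′ → trans
                (sumBelow-cong d (λ a a<d → LastTwoLetters.Aᵛᵛ-0≡s<c r d′ v m a a<d v≤ c))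
                (Aᵛ-total r (suc c) d′ m (s≤s c<r′))))
              (sym (sumFromTo-sumBelow 1 r _))) ⟩
    (L₁ + L₃) + L₂
  ≡⟨ +-swapʳ L₁ L₃ L₂ ⟩
    L₁ + L₂ + L₃ ∎
  where
  open ≡-Reasoning
  r = suc r′
  d = suc d′
  v = suc (d ∸ k)
  v≤ : v ≤ suc d
  v≤ = s≤s (m∸n≤m d k)
  K : ℕ → ℕ → ℕ
  K a c = Aᵛᵛ r d′ v 0 a c m
  L₁ = sumFromTo k d (λ j → A r 0 d (suc j) m)
  L₂ = sumFromTo 1 r (λ s → sumFromTo 0 d (λ j → A r s d (suc j) m))
  L₃ = sumFromTo 0 k (λ j → A r 0 d (suc j) (m - + 1))
  +-swapʳ : ∀ x y z → (x + y) + z ≡ (x + z) + y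
  +-swapʳ = solve-∀

recurrence-colourPositive : ∀ r d′ k → k ≤ suc d′ → (s : ℕ) → s < r → s ≢ 0 → (m : ℤ) →
  A r s (suc (suc d′)) (suc k) m
    ≡ sumFromTo k (suc d′) (λ j → A r s (suc d′) (suc j) m)
      + sumFromTo 1 s (λ l → sumFromTo 0 (suc d′) (λ j → A r l (suc d′) (suc j) m))
      + sumFromTo 0 (suc d′) (λ j → A r 0 (suc d′) (suc j) (m - + 1))
      + sumFromTo 0 k (λ j → A r s (suc d′) (suc j) (m - + 1))
      + sumFromTo (suc s) r (λ l → sumFromTo 0 (suc d′) (λ j → A r l (suc d′) (suc j) (m - + 1)))
recurrence-colourPositive r d′ k k≤d zero     s<r s≢0 m = ⊥-elim (s≢0 refl)
recurrence-colourPositive r d′ k k≤d (suc s′) s<r s≢0 m = begin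
    A r s (suc d) (suc k) m
  ≡⟨ A-lastTwoLetters r d′ k s m k≤d s<r ⟩
    sumBelow r Col
  ≡⟨ sumBelow-around s r Col s<r ⟩
    (Col 0 + sumBelow s′ (Col ∘ suc)) + (Col s + sumBelow (r ∸ suc s) (λ i → Col (suc (s + i))))
  ≡⟨ cong₂ _+_ (cong₂ _+_ colour0 lowerColours) (cong₂ _+_ sameColour higherColours) ⟩
    (L₃ + L₂) + ((L₁ + L₄) + L₅)
  ≡⟨ rearrange L₁ L₂ L₃ L₄ L₅ ⟩
    L₁ + L₂ + L₃ + L₄ + L₅ ∎
  where
  open ≡-Reasoning
  s = suc s′
  d = suc d′
  v = suc (d ∸ k)
  v≤ : v ≤ suc d
  v≤ = s≤s (m∸n≤m d k)
  Col : ℕ → ℕ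
  Col c = sumBelow d (λ a → Aᵛᵛ r d′ v s a c m)
  L₁ = sumFromTo k d (λ j → A r s d (suc j) m)
  L₂ = sumFromTo 1 s (λ l → sumFromTo 0 d (λ j → A r l d (suc j) m))
  L₃ = sumFromTo 0 d (λ j → A r 0 d (suc j) (m - + 1))
  L₄ = sumFromTo 0 k (λ j → A r s d (suc j) (m - + 1))
  L₅ = sumFromTo (suc s) r (λ l → sumFromTo 0 d (λ j → A r l d (suc j) (m - + 1)))
  rearrange : ∀ x₁ x₂ x₃ x₄ x₅ → (x₃ + x₂) + ((x₁ + x₄) + x₅) ≡ x₁ + x₂ + x₃ + x₄ + x₅
  rearrange = solve-∀
  colour0 : Col 0 ≡ L₃
  colour0 = trans (sumBelow-cong d (λ a a<d → LastTwoLetters.Aᵛᵛ-0≡c<s r d′ v m a a<d v≤ s′))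
                  (Aᵛ-total r 0 d′ (m - + 1) (≤-trans (s≤s z≤n) s<r))
  lowerColours : sumBelow s′ (Col ∘ suc) ≡ L₂
  lowerColours = trans (sumBelow-cong s′ (λ c c<s′ → trans
    (sumBelow-cong d (λ a a<d → LastTwoLetters.Aᵛᵛ-0<c<s r d′ v m a a<d v≤ s′ c c<s′))
    (Aᵛ-total r (suc c) d′ m (<-trans (s≤s c<s′) s<r))))
    (sym (sumFromTo-sumBelow 1 s _))
  sameColour : Col s ≡ L₁ + L₄
  sameColour = trans (sumBelow-cong d (λ a a<d → LastTwoLetters.Aᵛᵛ-c≡s r d′ v m a a<d v≤ s))
                     (Aᵛ-sameColour r s d′ k m s<r k≤d)
  higherColours : sumBelow (r ∸ suc s) (λ i → Col (suc (s + i))) ≡ L₅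
  higherColours = trans (sumBelow-cong (r ∸ suc s) (λ i i< → trans
    (sumBelow-cong d (λ a a<d → LastTwoLetters.Aᵛᵛ-0<s<c r d′ v m a a<d v≤ s′ (suc (s′ + i)) (s≤s (m≤m+n s′ i))))
    (Aᵛ-total r (suc (s + i)) d′ (m - + 1) (<∸⇒+< (suc s) r i i<))))
    (sym (sumFromTo-sumBelow (suc s) r _))

-- The symmetries

n-[1+n-m]≡m-1 : ∀ n m → + n - (+ suc n - m) ≡ m - + 1
n-[1+n-m]≡m-1 n m rewrite pos-+ 1 n = identity (+ n) m
  where
  identity : ∀ N m → N - ((+ 1 Z.+ N) - m) ≡ m - + 1
  identity = ℤ-solve-∀

n-[[1+n-m]-1]≡m : ∀ n m → + n - ((+ suc n - m) - + 1) ≡ m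
n-[[1+n-m]-1]≡m n m rewrite pos-+ 1 n = identity (+ n) m
  where
  identity : ∀ N m → N - (((+ 1 Z.+ N) - m) - + 1) ≡ m
  identity = ℤ-solve-∀

n-[n-m]≡m : ∀ n m → + n - (+ n - m) ≡ m
n-[n-m]≡m n m = identity (+ n) m
  where
  identity : ∀ N m → N - (N - m) ≡ m
  identity = ℤ-solve-∀

n-[[2+n-m]-1]≡m-1 : ∀ n m → + n - ((+ suc (suc n) - m) - + 1) ≡ m - + 1
n-[[2+n-m]-1]≡m-1 n m rewrite pos-+ 2 n = identity (+ n) m
  where
  identity : ∀ N m → N - (((+ 2 Z.+ N) - m) - + 1) ≡ m - + 1
  identity = ℤ-solve-∀

module Symmetry (r′ : ℕ) where

  private
    r = suc r′

  Symmetric₀ : ℕ → Set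
  Symmetric₀ n = ∀ k → k ≤ n → ∀ m → A r 0 (suc n) (suc k) m ≡ A r 0 (suc n) (suc (n ∸ k)) (+ n - m)

  Symmetric₊ : ℕ → Set
  Symmetric₊ n = ∀ e → 0 < e → e < r → ∀ k → k ≤ n → ∀ m →
    A r e (suc n) (suc k) m ≡ A r (r ∸ e) (suc n) (suc (n ∸ k)) (+ suc n - m)

  symmetric₀-base : Symmetric₀ 0
  symmetric₀-base zero z≤n m =
    trans (A≡Aᵛ r 0 0 0 m (s≤s z≤n) z≤n)
    (trans (Aᵛ-singleton m) (sym (A≡Aᵛ r 0 0 0 (+ 0 - m) (s≤s z≤n) z≤n)))
    where
    Aᵛ-singleton : ∀ m → Aᵛ r 0 0 1 m ≡ Aᵛ r 0 0 1 (+ 0 - m)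
    Aᵛ-singleton (+ zero)     = refl
    Aᵛ-singleton (+ suc m)    = refl
    Aᵛ-singleton (ℤ.negsuc m) = refl

  -- A single letter of nonzero colour violates ε₁ = 0: both sides are 0.
  symmetric₊-base : Symmetric₊ 0
  symmetric₊-base (suc e) _ e<r zero z≤n m = begin
      A r (suc e) 1 1 m                  ≡⟨ A≡Aᵛ r (suc e) 0 0 m e<r z≤n ⟩
      Aᵛ r (suc e) 0 1 m                 ≡⟨⟩
      0                                  ≡⟨⟩
      Aᵛ r (suc (r′ ∸ suc e)) 0 1 (+ 1 - m) ≡⟨ cong (λ c → Aᵛ r c 0 1 (+ 1 - m)) (+-∸-assoc 1 (≤-pred e<r)) ⟨
      Aᵛ r (r ∸ suc e) 0 1 (+ 1 - m)     ≡⟨ A≡Aᵛ r (r ∸ suc e) 0 0 (+ 1 - m) (∸-monoʳ-< (s≤s z≤n) (<⇒≤ e<r)) z≤n ⟨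
      A r (r ∸ suc e) 1 1 (+ 1 - m)      ∎
    where open ≡-Reasoning

  colourSum : ℕ → ℕ → ℤ → ℕ
  colourSum d c μ = sumFromTo 0 d (λ j → A r c d (suc j) μ)

  colourRange-reflect : ∀ n → Symmetric₊ n → ∀ a b μ ν → + suc n - μ ≡ ν → 0 < a → a ≤ b → b ≤ r →
    sumFromTo a b (λ l → colourSum (suc n) l μ) ≡ sumFromTo (suc r ∸ b) (suc r ∸ a) (λ c → colourSum (suc n) c ν)
  colourRange-reflect n h₊ a b μ ν μ+ν≡ 0<a a≤b b≤r =
    trans (sumFromTo-cong a b (λ l a≤l l<b → sumFromTo-reflect-all n (λ j j≤n →
            trans (h₊ l (<-≤-trans 0<a a≤l) (<-≤-trans l<b b≤r) j j≤n μ) (cong (A r (r ∸ l) (suc n) (suc (n ∸ j))) μ+ν≡))))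
          (sumFromTo-reflect a b r (λ c → colourSum (suc n) c ν) a≤b (m≤n⇒m≤1+n b≤r))

  symmetric₀-step : ∀ n → Symmetric₀ n → Symmetric₊ n → Symmetric₀ (suc n)
  symmetric₀-step n h₀ h₊ k k≤d m = begin
      A r 0 (suc d) (suc k) m
    ≡⟨ recurrence-colour0 r n k (s≤s z≤n) k≤d m ⟩
      L₁ + L₂ + L₃
    ≡⟨ +-reverse₃ L₁ L₂ L₃ ⟩
      L₃ + L₂ + L₁
    ≡⟨ cong₂ _+_ (cong₂ _+_ R₁≡L₃ R₂≡L₂) R₃≡L₁ ⟨
      R₁ + R₂ + R₃
    ≡⟨ recurrence-colour0 r n (d ∸ k) (s≤s z≤n) (m∸n≤m d k) M ⟨
      A r 0 (suc d) (suc (d ∸ k)) M ∎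
    where
    open ≡-Reasoning
    d = suc n
    M = + d - m
    L₁ = sumFromTo k d (λ j → A r 0 d (suc j) m)
    L₂ = sumFromTo 1 r (λ s → colourSum d s m)
    L₃ = sumFromTo 0 k (λ j → A r 0 d (suc j) (m - + 1))
    R₁ = sumFromTo (d ∸ k) d (λ j → A r 0 d (suc j) M)
    R₂ = sumFromTo 1 r (λ s → colourSum d s M)
    R₃ = sumFromTo 0 (d ∸ k) (λ j → A r 0 d (suc j) (M - + 1))
    +-reverse₃ : ∀ x y z → x + y + z ≡ z + y + x
    +-reverse₃ = solve-∀
    R₁≡L₃ : R₁ ≡ L₃
    R₁≡L₃ = sumFromTo-reflect-suffix n k (λ j j≤n →
      trans (h₀ j j≤n M) (cong (A r 0 d (suc (n ∸ j))) (n-[1+n-m]≡m-1 n m))) k≤d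
    R₂≡L₂ : R₂ ≡ L₂
    R₂≡L₂ = trans (colourRange-reflect n h₊ 1 r M m (n-[n-m]≡m d m) (s≤s z≤n) (s≤s z≤n) ≤-refl)
                  (cong (λ x → sumFromTo x r (λ s → colourSum d s m)) (m+n∸n≡m 1 r))
    R₃≡L₁ : R₃ ≡ L₁
    R₃≡L₁ = sumFromTo-reflect-prefix n k (λ j j≤n →
      trans (h₀ j j≤n (M - + 1)) (cong (A r 0 d (suc (n ∸ j))) (n-[[1+n-m]-1]≡m n m))) k≤d

  symmetric₊-step : ∀ n → Symmetric₀ n → Symmetric₊ n → Symmetric₊ (suc n)
  symmetric₊-step n h₀ h₊ e 0<e e<r k k≤d m = begin
      A r e (suc d) (suc k) m
    ≡⟨ recurrence-colourPositive r n k k≤d e e<r (≢-sym (<⇒≢ 0<e)) m ⟩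
      L₁ + L₂ + L₃ + L₄ + L₅
    ≡⟨ rearrange L₁ L₂ L₃ L₄ L₅ ⟩
      L₄ + L₅ + L₃ + L₁ + L₂
    ≡⟨ cong₂ _+_ (cong₂ _+_ (cong₂ _+_ (cong₂ _+_ R₁≡L₄ R₂≡L₅) R₃≡L₃) R₄≡L₁) R₅≡L₂ ⟨
      R₁ + R₂ + R₃ + R₄ + R₅
    ≡⟨ recurrence-colourPositive r n (d ∸ k) (m∸n≤m d k) ē ē<r (≢-sym (<⇒≢ 0<ē)) M ⟨
      A r ē (suc d) (suc (d ∸ k)) M ∎
    where
    open ≡-Reasoning
    d = suc n
    ē = r ∸ e
    M = + suc d - m
    ē<r : ē < r
    ē<r = ∸-monoʳ-< 0<e (<⇒≤ e<r)
    0<ē : 0 < ē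
    0<ē = m<n⇒0<n∸m e<r
    r∸ē≡e : r ∸ ē ≡ e
    r∸ē≡e = m∸[m∸n]≡n (<⇒≤ e<r)
    L₁ = sumFromTo k d (λ j → A r e d (suc j) m)
    L₂ = sumFromTo 1 e (λ l → colourSum d l m)
    L₃ = colourSum d 0 (m - + 1)
    L₄ = sumFromTo 0 k (λ j → A r e d (suc j) (m - + 1))
    L₅ = sumFromTo (suc e) r (λ l → colourSum d l (m - + 1))
    R₁ = sumFromTo (d ∸ k) d (λ j → A r ē d (suc j) M)
    R₂ = sumFromTo 1 ē (λ l → colourSum d l M)
    R₃ = colourSum d 0 (M - + 1)
    R₄ = sumFromTo 0 (d ∸ k) (λ j → A r ē d (suc j) (M - + 1))
    R₅ = sumFromTo (suc ē) r (λ l → colourSum d l (M - + 1))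
    rearrange : ∀ x₁ x₂ x₃ x₄ x₅ → x₁ + x₂ + x₃ + x₄ + x₅ ≡ x₄ + x₅ + x₃ + x₁ + x₂
    rearrange = solve-∀
    R₁≡L₄ : R₁ ≡ L₄
    R₁≡L₄ = sumFromTo-reflect-suffix n k (λ j j≤n → trans (h₊ ē 0<ē ē<r j j≤n M)
      (cong₂ (λ c μ → A r c d (suc (n ∸ j)) μ) r∸ē≡e (n-[1+n-m]≡m-1 d m))) k≤d
    R₂≡L₅ : R₂ ≡ L₅
    R₂≡L₅ = trans (colourRange-reflect n h₊ 1 ē M (m - + 1) (n-[1+n-m]≡m-1 d m) (s≤s z≤n) 0<ē (<⇒≤ ē<r))
      (cong (λ x → sumFromTo x r (λ l → colourSum d l (m - + 1))) (trans (+-∸-assoc 1 (m∸n≤m r e)) (cong suc r∸ē≡e)))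
    R₃≡L₃ : R₃ ≡ L₃
    R₃≡L₃ = sumFromTo-reflect-all n (λ j j≤n →
      trans (h₀ j j≤n (M - + 1)) (cong (A r 0 d (suc (n ∸ j))) (n-[[2+n-m]-1]≡m-1 n m)))
    R₄≡L₁ : R₄ ≡ L₁
    R₄≡L₁ = sumFromTo-reflect-prefix n k (λ j j≤n → trans (h₊ ē 0<ē ē<r j j≤n (M - + 1))
      (cong₂ (λ c μ → A r c d (suc (n ∸ j)) μ) r∸ē≡e (n-[[1+n-m]-1]≡m d m))) k≤d
    R₅≡L₂ : R₅ ≡ L₂
    R₅≡L₂ = trans (colourRange-reflect n h₊ (suc ē) r (M - + 1) m (n-[[1+n-m]-1]≡m d m) (s≤s z≤n) ē<r ≤-refl)
      (cong₂ (λ x y → sumFromTo x y (λ l → colourSum d l m)) (m+n∸n≡m 1 r) r∸ē≡e)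

  symmetric : ∀ n → Symmetric₀ n × Symmetric₊ n
  symmetric zero    = symmetric₀-base , symmetric₊-base
  symmetric (suc n) with symmetric n
  ... | h₀ , h₊ = symmetric₀-step n h₀ h₊ , symmetric₊-step n h₀ h₊

lemma3p1 : (r : ℕ) → 1 ≤ r → (d k : ℕ) → 1 ≤ d → k ≤ d →
    ((m : ℕ) → m ≤ d →
      A r 0 (suc d) (suc k) (+ m) ≡ A r 0 (suc d) (suc d ∸ k) (+ (d ∸ m)))
    × ((s : ℕ) → s < r → s ≢ 0 → (m : ℕ) → m ≤ suc d →
      A r s (suc d) (suc k) (+ m) ≡ A r (r ∸ s) (suc d) (suc d ∸ k) (+ (suc d ∸ m)))
    × ((m : ℤ) →
      A r 0 (suc d) (suc k) m
        ≡ sumFromTo k d (λ j → A r 0 d (suc j) m)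
          + sumFromTo 1 r (λ s → sumFromTo 0 d (λ j → A r s d (suc j) m))
          + sumFromTo 0 k (λ j → A r 0 d (suc j) (m - + 1)))
    × ((s : ℕ) → s < r → s ≢ 0 → (m : ℤ) →
      A r s (suc d) (suc k) m
        ≡ sumFromTo k d (λ j → A r s d (suc j) m)
          + sumFromTo 1 s (λ l → sumFromTo 0 d (λ j → A r l d (suc j) m))
          + sumFromTo 0 d (λ j → A r 0 d (suc j) (m - + 1))
          + sumFromTo 0 k (λ j → A r s d (suc j) (m - + 1))
          + sumFromTo (suc s) r (λ l → sumFromTo 0 d (λ j → A r l d (suc j) (m - + 1))))
lemma3p1 r@(suc r′) 1≤r d@(suc d′) k _ k≤d =
    (λ m m≤d → trans (proj₁ (symmetric d) k k≤d (+ m)) (cong₂ (A r 0 (suc d)) d+1∸k (n-m≡n∸m m≤d)))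
  , (λ s s<r s≢0 m m≤d+1 → trans (proj₂ (symmetric d) s (n≢0⇒n>0 s≢0) s<r k k≤d (+ m))
                                 (cong₂ (A r (r ∸ s) (suc d)) d+1∸k (n-m≡n∸m m≤d+1)))
  , recurrence-colour0 r d′ k 1≤r k≤d
  , recurrence-colourPositive r d′ k k≤d
  where
  open Symmetry r′
  d+1∸k : suc (d ∸ k) ≡ suc d ∸ k
  d+1∸k = sym (+-∸-assoc 1 k≤d)
  n-m≡n∸m : ∀ {n m} → m ≤ n → + n - + m ≡ + (n ∸ m)
  n-m≡n∸m {n} {m} m≤n = trans (m-n≡m⊖n n m) (⊖-≥ m≤n)
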